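{- Let $G$ be a connected graph of order $n$ having $t$ twin equivalence classes. If $G$ has no singleton twin equivalence class, then $$\operatorname{dim}_A(G)=\operatorname{dim}(G)=n-t.$$
   Context: All graphs are finite, simple, undirected. The twin equivalence relation on $V(G)$ is: $x\,\mathcal R\,y$ iff $N_G[x]=N_G[y]$ or $N_G(x)=N_G(y)$ (closed, resp. open neighbourhoods); its classes are the twin equivalence classes. For connected $G$ with shortest-path distance $d$, a metric generator is a vertex set $S$ such that every two distinct vertices $x,y$ satisfy $d(s,x)\ne d(s,y)$ for some $s\in S$; $\operatorname{dim}(G)$ is the minimum size of a metric generator. An adjacency generator is a set $S$ such that for every two distinct $x,y\in V(G)\setminus S$ there exists $s\in S$ with $|N_G(s)\cap\{x,y\}|=1$; $\operatorname{dim}_A(G)$ is the minimum size of an adjacency generator. -}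

module Defs where

open import Data.Nat using (ℕ; zero; suc; _≤_)
open import Data.Bool using (Bool; true; false; _∨_)
open import Data.Fin using (Fin; _≟_)
open import Data.Fin.Subset using (Subset; _∈_; _∉_; ∣_∣)
open import Data.Product using (Σ; ∃; ∃-syntax; _×_; _,_)
open import Data.Sum using (_⊎_)
open import Relation.Nullary using (¬_)
open import Relation.Nullary.Decidable using (⌊_⌋)
open import Relation.Binary.PropositionalEquality using (_≡_; _≢_)
open import Function.Bundles using (_⇔_)

record Graph (n : ℕ) : Set where
  field
    adj   : Fin n → Fin n → Bool
    sym   : ∀ x y → adj x y ≡ adj y x
    irrefl : ∀ x → adj x x ≡ false
open Graph public

module _ {n : ℕ} (G : Graph n) where

  data Walk : Fin n → Fin n → ℕ → Set where
    here : ∀ {x} → Walk x x zero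
    step : ∀ {x y z k} → adj G x y ≡ true → Walk y z k → Walk x z (suc k)

  Connected : Set
  Connected = ∀ x y → ∃[ k ] Walk x y k

  Dist : Fin n → Fin n → ℕ → Set
  Dist x y k = Walk x y k × (∀ m → Walk x y m → k ≤ m)

  OpenTwins : Fin n → Fin n → Set
  OpenTwins x y = ∀ z → adj G x z ≡ adj G y z

  closedN : Fin n → Fin n → Bool
  closedN x z = ⌊ x ≟ z ⌋ ∨ adj G x z

  ClosedTwins : Fin n → Fin n → Set
  ClosedTwins x y = ∀ z → closedN x z ≡ closedN y z

  Twins : Fin n → Fin n → Set
  Twins x y = ClosedTwins x y ⊎ OpenTwins x y

  -- G has exactly t twin equivalence classes: the quotient V(G)/R is
  -- in bijection with Fin t via a surjective class map f.
  HasTwinClasses : ℕ → Set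
  HasTwinClasses t =
    Σ (Fin n → Fin t) λ f →
      (∀ c → ∃[ x ] f x ≡ c) × (∀ x y → Twins x y ⇔ (f x ≡ f y))

  NoSingletonTwinClass : Set
  NoSingletonTwinClass = ∀ x → ∃[ y ] (y ≢ x × Twins x y)

  MetricGenerator : Subset n → Set
  MetricGenerator S =
    ∀ x y → x ≢ y →
      ∃[ s ] (s ∈ S × ∃[ a ] ∃[ b ] (Dist s x a × Dist s y b × a ≢ b))

  -- adjacency generator: |N(s) ∩ {x,y}| = 1, i.e. s adjacent to exactly one
  AdjacencyGenerator : Subset n → Set
  AdjacencyGenerator S =
    ∀ x y → x ∉ S → y ∉ S → x ≢ y →
      ∃[ s ] (s ∈ S × adj G s x ≢ adj G s y)

  MetricDim : ℕ → Set
  MetricDim m =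
    (∃[ S ] (MetricGenerator S × ∣ S ∣ ≡ m)) ×
    (∀ S → MetricGenerator S → m ≤ ∣ S ∣)

  AdjacencyDim : ℕ → Set
  AdjacencyDim m =
    (∃[ S ] (AdjacencyGenerator S × ∣ S ∣ ≡ m)) ×
    (∀ S → AdjacencyGenerator S → m ≤ ∣ S ∣)

module Submission where

-- Two twins x, y are indistinguishable from every other vertex w: w is
-- adjacent to x iff it is adjacent to y, and (replacing x by y inside a
-- shortest walk) d(w,x) = d(w,y).  Hence every metric generator contains all
-- but at most one vertex of each twin class, i.e. has size at least n - t;
-- since every adjacency generator of a connected graph is a metric generator,
-- the same bound holds for adjacency generators.
--
-- Conversely, choose one representative per twin class and let S be the set
-- of all other vertices, so |S| = n - t.  If two representatives x, y were
-- seen alike by every vertex of S, they would be seen alike by every vertex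
-- z outside {x, y}: either z is in S, or z is a representative and is seen
-- exactly like its twin z', which lies in S because no class is a singleton.
-- Two vertices on which all other vertices agree are twins (open or closed
-- according to whether they are adjacent), contradicting that x and y
-- represent different classes.  So S is an adjacency generator, hence also a
-- metric generator, and both dimensions equal n - t.

open import Defs
open import Data.Nat using (ℕ; _∸_; zero; suc; _≤_; _<_; z≤n; s≤s)
open import Data.Nat.Properties
  using (≤-trans; ≤-antisym; ≮⇒≥; ≤-reflexive; +-comm; m≤n+m∸n; m≤n+o⇒m∸n≤o; +-monoʳ-≤; anyUpTo?)
open import Data.Nat.Induction using (<-rec)
open import Data.Bool using (true; false)
open import Data.Bool.Properties using () renaming (_≟_ to _≟ᵇ_)
open import Data.Fin using (Fin; zero; suc; _≟_)
open import Data.Fin.Subset using (Subset; _∈_; _∉_; ∣_∣; _-_; inside; outside; ∁; ⊤)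
open import Data.Fin.Subset.Properties
  using (_∈?_; ∈⊤; ∣⊤∣≡n; ∣∁p∣≡n∸∣p∣; x∈p⇒∣p-x∣<∣p∣; x∈p∧x∉q⇒x∈p─q; x≢y⇒x∉⁅y⁆;
         x∈∁p⇒x∉p; x∉∁p⇒x∈p; x∉p⇒x∈∁p)
open import Data.Fin.Properties using (suc-injective; 0≢1+n; any?)
open import Data.Vec using (_∷_; []; tabulate) renaming (here to vhere; there to vthere)
open import Data.Vec.Properties using (lookup∘tabulate; []=⇒lookup; lookup⇒[]=)
open import Data.Product using (∃-syntax; _×_; _,_; proj₁; proj₂)
open import Data.Sum using (inj₁; inj₂)
open import Data.Empty using (⊥-elim)
open import Relation.Unary using (Pred; Decidable)
open import Relation.Nullary using (Dec; yes; no; does; ¬?; _×-dec_)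
open import Relation.Nullary.Decidable using (decidable-stable; dec-true)
open import Relation.Binary.PropositionalEquality
  using (_≡_; _≢_; refl; trans; cong; subst; subst₂; module ≡-Reasoning) renaming (sym to ≡-sym)
open import Function.Bundles using (Equivalence)
open import Function using (_∘_)

LeastWitness : ∀ {p} → Pred ℕ p → Set p
LeastWitness P = ∃[ m ] (P m × (∀ m' → P m' → m ≤ m'))

least-witness : ∀ {p} {P : Pred ℕ p} → Decidable P → ∀ k → P k → LeastWitness P
least-witness {P = P} P? = <-rec (λ k → P k → LeastWitness P) search
  where
  search : ∀ k → (∀ {j} → j < k → P j → LeastWitness P) → P k → LeastWitness P
  search k smaller pk with anyUpTo? P? k
  ... | yes (j , j<k , pj) = smaller j<k pj
  ... | no none = k , pk , λ m' pm' → ≮⇒≥ (λ m'<k → none (m' , m'<k , pm'))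

injection⇒∣p∣≤∣q∣ : ∀ {n t} (P : Subset n) (Q : Subset t) (g : Fin n → Fin t) →
  (∀ x → x ∈ P → g x ∈ Q) → (∀ x y → x ∈ P → y ∈ P → g x ≡ g y → x ≡ y) →
  ∣ P ∣ ≤ ∣ Q ∣
injection⇒∣p∣≤∣q∣ [] Q g into inj = z≤n
injection⇒∣p∣≤∣q∣ (outside ∷ P) Q g into inj =
  injection⇒∣p∣≤∣q∣ P Q (g ∘ suc) (λ x x∈P → into (suc x) (vthere x∈P))
    (λ x y x∈P y∈P e → suc-injective (inj (suc x) (suc y) (vthere x∈P) (vthere y∈P) e))
-- the head goes to g zero; the tail maps injectively into Q minus g zero
injection⇒∣p∣≤∣q∣ (inside ∷ P) Q g into inj =
  ≤-trans (s≤s (injection⇒∣p∣≤∣q∣ P (Q - g zero) (g ∘ suc) into-rest inj-rest))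
          (x∈p⇒∣p-x∣<∣p∣ (into zero vhere))
  where
  inj-rest : ∀ x y → x ∈ P → y ∈ P → g (suc x) ≡ g (suc y) → x ≡ y
  inj-rest x y x∈P y∈P e = suc-injective (inj (suc x) (suc y) (vthere x∈P) (vthere y∈P) e)
  into-rest : ∀ x → x ∈ P → g (suc x) ∈ Q - g zero
  into-rest x x∈P = x∈p∧x∉q⇒x∈p─q (into (suc x) (vthere x∈P))
    (x≢y⇒x∉⁅y⁆ (0≢1+n ∘ ≡-sym ∘ inj (suc x) zero (vthere x∈P) vhere))

select : ∀ {n p} {P : Pred (Fin n) p} → Decidable P → Subset n
select P? = tabulate (does ∘ P?)

∈-select : ∀ {n p} {P : Pred (Fin n) p} (P? : Decidable P) {x} → x ∈ select P? → P x
∈-select P? {x} x∈ with P? x | trans (≡-sym (lookup∘tabulate (does ∘ P?) x)) ([]=⇒lookup x∈)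
... | yes px | _ = px
... | no _ | ()

select-∈ : ∀ {n p} {P : Pred (Fin n) p} (P? : Decidable P) {x} → P x → x ∈ select P?
select-∈ P? {x} px = lookup⇒[]= x (select P?) (trans (lookup∘tabulate (does ∘ P?) x) (dec-true (P? x) px))

∈∉⇒≢ : ∀ {n} {S : Subset n} {s v} → s ∈ S → v ∉ S → s ≢ v
∈∉⇒≢ s∈S v∉S refl = v∉S s∈S

complement-bound : ∀ n s t → n ∸ s ≤ t → n ∸ t ≤ s
complement-bound n s t n∸s≤t = m≤n+o⇒m∸n≤o n t
  (≤-trans (m≤n+m∸n n s) (≤-trans (+-monoʳ-≤ s n∸s≤t) (≤-reflexive (+-comm s t))))

module _ {n : ℕ} (G : Graph n) where

  closedN-self : ∀ x → closedN G x x ≡ true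
  closedN-self x with x ≟ x
  ... | yes _ = refl
  ... | no x≢x = ⊥-elim (x≢x refl)

  closedN-other : ∀ {x z} → z ≢ x → closedN G x z ≡ adj G x z
  closedN-other {x} {z} z≢x with x ≟ z
  ... | yes x≡z = ⊥-elim (z≢x (≡-sym x≡z))
  ... | no _ = refl

  twins-sym : ∀ {x y} → Twins G x y → Twins G y x
  twins-sym (inj₁ closed-twins) = inj₁ (≡-sym ∘ closed-twins)
  twins-sym (inj₂ open-twins) = inj₂ (≡-sym ∘ open-twins)

  twins-see-alike : ∀ {x y w} → Twins G x y → w ≢ x → w ≢ y → adj G x w ≡ adj G y w
  twins-see-alike {x} {y} {w} (inj₁ closed-twins) w≢x w≢y = begin
    adj G x w     ≡⟨ ≡-sym (closedN-other w≢x) ⟩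
    closedN G x w ≡⟨ closed-twins w ⟩
    closedN G y w ≡⟨ closedN-other w≢y ⟩
    adj G y w     ∎
    where open ≡-Reasoning
  twins-see-alike {w = w} (inj₂ open-twins) _ _ = open-twins w

  twins-seen-alike : ∀ {x y w} → Twins G x y → w ≢ x → w ≢ y → adj G w x ≡ adj G w y
  twins-seen-alike {x} {y} {w} T w≢x w≢y =
    trans (sym G w x) (trans (twins-see-alike T w≢x w≢y) (sym G y w))

  seen⇒see : ∀ {x y z} → adj G z x ≡ adj G z y → adj G x z ≡ adj G y z
  seen⇒see {x} {y} {z} seen = trans (sym G x z) (trans seen (sym G z y))

  -- Conversely, two vertices seen alike by all other vertices are twins:
  -- closed twins if they are adjacent, open twins otherwise.
  seen-alike⇒twins : ∀ {x y} → (∀ z → z ≢ x → z ≢ y → adj G z x ≡ adj G z y) → Twins G x y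
  seen-alike⇒twins {x} {y} seen-alike with adj G x y in xy
  ... | false = inj₂ open-twins
    where
    open-twins : OpenTwins G x y
    open-twins z with z ≟ x | z ≟ y
    ... | yes refl | _ = trans (irrefl G z) (≡-sym (trans (sym G y z) xy))
    ... | no _ | yes refl = trans xy (≡-sym (irrefl G z))
    ... | no z≢x | no z≢y = seen⇒see (seen-alike z z≢x z≢y)
  ... | true = inj₁ closed-twins
    where
    closed-twins : ClosedTwins G x y
    closed-twins z with z ≟ x | z ≟ y
    ... | yes refl | yes refl = refl
    ... | yes refl | no z≢y =
      trans (closedN-self z) (≡-sym (trans (closedN-other z≢y) (trans (sym G y z) xy)))
    ... | no z≢x | yes refl = trans (closedN-other z≢x) (trans xy (≡-sym (closedN-self z)))
    ... | no z≢x | no z≢y =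
      trans (closedN-other z≢x) (trans (seen⇒see (seen-alike z z≢x z≢y)) (≡-sym (closedN-other z≢y)))

  -- Walks of fixed length are decidable, so shortest paths exist.
  walk? : ∀ k x y → Dec (Walk G x y k)
  walk? zero x y with x ≟ y
  ... | yes refl = yes here
  ... | no x≢y = no λ { here → x≢y refl }
  walk? (suc k) x y with any? (λ u → (adj G x u ≟ᵇ true) ×-dec walk? k u y)
  ... | yes (u , xu , walk) = yes (step xu walk)
  ... | no none = no λ { (step xu walk) → none (_ , xu , walk) }

  distance : Connected G → ∀ x y → ∃[ k ] Dist G x y k
  distance connected x y = least-witness (λ k → walk? k x y) (proj₁ (connected x y)) (proj₂ (connected x y))

  walk-length-0 : ∀ {x y} → Walk G x y 0 → x ≡ y
  walk-length-0 here = refl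

  -- A walk from s to x, with s ≠ x, yields a walk at most as long from s to
  -- any twin y of x: cut it at its first visit to y, or else replace its last
  -- edge into x by the corresponding edge into y.
  walk-to-twin : ∀ {x y s k} → Twins G x y → s ≢ x → Walk G s x k → ∃[ m ] (m ≤ k × Walk G s y m)
  walk-to-twin T s≢x here = ⊥-elim (s≢x refl)
  walk-to-twin {x} {y} {s} T s≢x (step {y = u} su walk) with s ≟ y | u ≟ x
  ... | yes refl | _ = 0 , z≤n , here
  ... | no s≢y | yes refl = 1 , s≤s z≤n , step (trans (≡-sym (twins-seen-alike T s≢x s≢y)) su) here
  ... | no _ | no u≢x with walk-to-twin T u≢x walk
  ...   | m , m≤k , walk' = suc m , s≤s m≤k , step su walk'

  twins-equidistant : ∀ {x y s a b} → Twins G x y → s ≢ x → s ≢ y →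
    Dist G s x a → Dist G s y b → a ≡ b
  twins-equidistant T s≢x s≢y (walk-a , min-a) (walk-b , min-b)
    with walk-to-twin T s≢x walk-a | walk-to-twin (twins-sym T) s≢y walk-b
  ... | m , m≤a , walk-y | m' , m'≤b , walk-x =
    ≤-antisym (≤-trans (min-a m' walk-x) m'≤b) (≤-trans (min-b m walk-y) m≤a)

  Resolves : Fin n → Fin n → Fin n → Set
  Resolves s x y = ∃[ a ] ∃[ b ] (Dist G s x a × Dist G s y b × a ≢ b)

  resolves-sym : ∀ {s x y} → Resolves s x y → Resolves s y x
  resolves-sym (a , b , da , db , a≢b) = b , a , db , da , a≢b ∘ ≡-sym

  resolves-self : Connected G → ∀ {x y} → x ≢ y → Resolves x x y
  resolves-self connected {x} {y} x≢y with distance connected x y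
  ... | b , db = 0 , b , (here , λ _ _ → z≤n) , db ,
                 λ 0≡b → x≢y (walk-length-0 (subst (Walk G x y) (≡-sym 0≡b) (proj₁ db)))

  neighbour-resolves : Connected G → ∀ {s x y} → s ≢ x →
    adj G s x ≡ true → adj G s y ≡ false → Resolves s x y
  neighbour-resolves connected {s} {x} {y} s≢x sx sy with distance connected s y
  ... | b , db = 1 , b , (step sx here , at-least-1) , db , not-1
    where
    at-least-1 : ∀ m → Walk G s x m → 1 ≤ m
    at-least-1 zero walk = ⊥-elim (s≢x (walk-length-0 walk))
    at-least-1 (suc m) _ = s≤s z≤n
    not-1 : 1 ≢ b
    not-1 refl with proj₁ db
    ... | step sy' here with trans (≡-sym sy') sy
    ...   | ()

  adjacency-resolves : Connected G → ∀ {s x y} → s ≢ x → s ≢ y →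
    adj G s x ≢ adj G s y → Resolves s x y
  adjacency-resolves connected {s} {x} {y} s≢x s≢y differ with adj G s x in sx | adj G s y in sy
  ... | true | false = neighbour-resolves connected s≢x sx sy
  ... | false | true = resolves-sym (neighbour-resolves connected s≢y sy sx)
  ... | true | true = ⊥-elim (differ refl)
  ... | false | false = ⊥-elim (differ refl)

  adjacency⇒metric : Connected G → ∀ S → AdjacencyGenerator G S → MetricGenerator G S
  adjacency⇒metric connected S generator x y x≢y with x ∈? S | y ∈? S
  ... | yes x∈S | _ = x , x∈S , resolves-self connected x≢y
  ... | no _ | yes y∈S = y , y∈S , resolves-sym (resolves-self connected (x≢y ∘ ≡-sym))
  ... | no x∉S | no y∉S with generator x y x∉S y∉S x≢y
  ...   | s , s∈S , differ =
    s , s∈S , adjacency-resolves connected (∈∉⇒≢ s∈S x∉S) (∈∉⇒≢ s∈S y∉S) differ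

  metric-generator-meets-twins : ∀ S → MetricGenerator G S →
    ∀ x y → x ∉ S → y ∉ S → Twins G x y → x ≡ y
  metric-generator-meets-twins S generator x y x∉S y∉S T with x ≟ y
  ... | yes x≡y = x≡y
  ... | no x≢y with generator x y x≢y
  ...   | s , s∈S , a , b , da , db , a≢b =
    ⊥-elim (a≢b (twins-equidistant T (∈∉⇒≢ s∈S x∉S) (∈∉⇒≢ s∈S y∉S) da db))

  twin-transversal⇒adjacency : ∀ S →
    (∀ x → x ∉ S → ∃[ x' ] (x' ∈ S × Twins G x x')) →
    (∀ x y → x ∉ S → y ∉ S → Twins G x y → x ≡ y) →
    AdjacencyGenerator G S
  twin-transversal⇒adjacency S has-twin non-twins x y x∉S y∉S x≢y
    with any? (λ s → (s ∈? S) ×-dec ¬? (adj G s x ≟ᵇ adj G s y))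
  ... | yes separator = separator
  ... | no none = ⊥-elim (x≢y (non-twins x y x∉S y∉S (seen-alike⇒twins alike-outside)))
    where
    -- if no separator exists, every vertex of S sees x and y alike
    S-alike : ∀ s → s ∈ S → adj G s x ≡ adj G s y
    S-alike s s∈S = decidable-stable (adj G s x ≟ᵇ adj G s y) (λ differ → none (s , s∈S , differ))
    -- then every vertex z other than x, y sees them alike: a vertex z ∉ S is
    -- seen like its twin in S
    alike-outside : ∀ z → z ≢ x → z ≢ y → adj G z x ≡ adj G z y
    alike-outside z z≢x z≢y with z ∈? S
    ... | yes z∈S = S-alike z z∈S
    ... | no z∉S with has-twin z z∉S
    ...   | z' , z'∈S , T = begin
      adj G z x  ≡⟨ twins-see-alike T (z≢x ∘ ≡-sym) (∈∉⇒≢ z'∈S x∉S ∘ ≡-sym) ⟩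
      adj G z' x ≡⟨ S-alike z' z'∈S ⟩
      adj G z' y ≡⟨ ≡-sym (twins-see-alike T (z≢y ∘ ≡-sym) (∈∉⇒≢ z'∈S y∉S ∘ ≡-sym)) ⟩
      adj G z y  ∎
      where open ≡-Reasoning

  module TwinClasses {t : ℕ} (classes : HasTwinClasses G t) where

    class : Fin n → Fin t
    class = proj₁ classes

    representative : Fin t → Fin n
    representative c = proj₁ (proj₁ (proj₂ classes) c)

    class-of-representative : ∀ c → class (representative c) ≡ c
    class-of-representative c = proj₂ (proj₁ (proj₂ classes) c)

    twins⇒same-class : ∀ {x y} → Twins G x y → class x ≡ class y
    twins⇒same-class {x} {y} = Equivalence.to (proj₂ (proj₂ classes) x y)

    same-class⇒twins : ∀ {x y} → class x ≡ class y → Twins G x y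
    same-class⇒twins {x} {y} = Equivalence.from (proj₂ (proj₂ classes) x y)

    -- If no two distinct twins lie outside S, then S misses at most one
    -- vertex per class, so |S| ≥ n - t.
    twin-free-complement⇒bound : ∀ S → (∀ x y → x ∉ S → y ∉ S → Twins G x y → x ≡ y) →
      n ∸ t ≤ ∣ S ∣
    twin-free-complement⇒bound S non-twins = complement-bound n ∣ S ∣ t
      (subst₂ _≤_ (∣∁p∣≡n∸∣p∣ S) (∣⊤∣≡n t)
        (injection⇒∣p∣≤∣q∣ (∁ S) ⊤ class (λ _ _ → ∈⊤) class-injective))
      where
      class-injective : ∀ x y → x ∈ ∁ S → y ∈ ∁ S → class x ≡ class y → x ≡ y
      class-injective x y x∈ y∈ same =
        non-twins x y (x∈∁p⇒x∉p x∈) (x∈∁p⇒x∉p y∈) (same-class⇒twins same)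

    Representatives : Subset n
    Representatives = select (λ x → x ≟ representative (class x))

    NonRepresentatives : Subset n
    NonRepresentatives = ∁ Representatives

    representatives-non-twins : ∀ x y → x ∈ Representatives → y ∈ Representatives →
      Twins G x y → x ≡ y
    representatives-non-twins x y x∈ y∈ T = begin
      x                          ≡⟨ ∈-select (λ v → v ≟ representative (class v)) x∈ ⟩
      representative (class x)   ≡⟨ cong representative (twins⇒same-class T) ⟩
      representative (class y)   ≡⟨ ≡-sym (∈-select (λ v → v ≟ representative (class v)) y∈) ⟩
      y                          ∎
      where open ≡-Reasoning

    ∣Representatives∣≡t : ∣ Representatives ∣ ≡ t
    ∣Representatives∣≡t = ≤-antisym
      (subst (∣ Representatives ∣ ≤_) (∣⊤∣≡n t)
        (injection⇒∣p∣≤∣q∣ Representatives ⊤ class (λ _ _ → ∈⊤)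
          (λ x y x∈ y∈ → representatives-non-twins x y x∈ y∈ ∘ same-class⇒twins)))
      (subst (_≤ ∣ Representatives ∣) (∣⊤∣≡n t)
        (injection⇒∣p∣≤∣q∣ ⊤ Representatives representative
          (λ c _ → select-∈ (λ v → v ≟ representative (class v))
                     (cong representative (≡-sym (class-of-representative c))))
          (λ c d _ _ same → trans (≡-sym (class-of-representative c))
                              (trans (cong class same) (class-of-representative d)))))

    ∣NonRepresentatives∣≡n∸t : ∣ NonRepresentatives ∣ ≡ n ∸ t
    ∣NonRepresentatives∣≡n∸t = trans (∣∁p∣≡n∸∣p∣ Representatives) (cong (n ∸_) ∣Representatives∣≡t)

    -- Without singleton classes, every representative has a twin among the
    -- non-representatives, so the latter form an adjacency generator.
    non-representatives-generate : NoSingletonTwinClass G → AdjacencyGenerator G NonRepresentatives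
    non-representatives-generate no-singleton =
      twin-transversal⇒adjacency NonRepresentatives has-twin
        (λ x y x∉ y∉ → representatives-non-twins x y (x∉∁p⇒x∈p x∉) (x∉∁p⇒x∈p y∉))
      where
      has-twin : ∀ x → x ∉ NonRepresentatives → ∃[ x' ] (x' ∈ NonRepresentatives × Twins G x x')
      has-twin x x∉ with no-singleton x
      ... | x' , x'≢x , T = x' , x∉p⇒x∈∁p x'∉ , T
        where
        x'∉ : x' ∉ Representatives
        x'∉ x'∈ = x'≢x (representatives-non-twins x' x x'∈ (x∉∁p⇒x∈p x∉) (twins-sym T))

theorem27 : (n : ℕ) (G : Graph n) (t : ℕ) →
    Connected G → HasTwinClasses G t → NoSingletonTwinClass G →
    AdjacencyDim G (n ∸ t) × MetricDim G (n ∸ t)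
theorem27 n G t connected classes no-singleton =
    ((NonRepresentatives , adjacency-generator , ∣NonRepresentatives∣≡n∸t) , adjacency-lower-bound)
  , ((NonRepresentatives , adjacency⇒metric G connected NonRepresentatives adjacency-generator
                         , ∣NonRepresentatives∣≡n∸t)
    , metric-lower-bound)
  where
  open TwinClasses G classes

  adjacency-generator : AdjacencyGenerator G NonRepresentatives
  adjacency-generator = non-representatives-generate no-singleton

  metric-lower-bound : ∀ S → MetricGenerator G S → n ∸ t ≤ ∣ S ∣
  metric-lower-bound S generator =
    twin-free-complement⇒bound S (metric-generator-meets-twins G S generator)

  adjacency-lower-bound : ∀ S → AdjacencyGenerator G S → n ∸ t ≤ ∣ S ∣
  adjacency-lower-bound S = metric-lower-bound S ∘ adjacency⇒metric G connected S
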